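{- There exists a $2$-$(66,6,1)$ design (having exactly $143$ blocks) such that: (1) the block graph of the design has exactly $80$ maximum cliques, of which exactly $66$ are canonical and exactly $14$ are non-canonical; (2) none of the $14$ non-canonical maximum cliques has a design structure.
   Context: A $2$-$(n,m,1)$ design is a collection of $m$-subsets (blocks) of an $n$-set (points) such that every pair of distinct points lies in exactly one block. The block graph of such a design has the blocks as vertices, two distinct blocks being adjacent if and only if they intersect. For a $2$-$(n,m,1)$ design that is not symmetric (i.e. has more blocks than points, as here: $143>66$), the maximum clique size of the block graph is $\frac{n-1}{m-1}$ (here $13$). A clique of this size consisting of all blocks containing a fixed point is called canonical; other maximum cliques are non-canonical. A set $C$ of blocks has a design structure if, taking as point set the union $U$ of the blocks in $C$, the blocks of $C$ form a $2$-$(|U|,m,1)$ design on $U$. -}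

module Defs where

open import Data.Nat using (ℕ; _≤_)
open import Data.Fin using (Fin)
open import Data.Fin.Subset using (Subset; _∈_; ∣_∣)
open import Data.Product using (Σ; ∃; _×_)
open import Relation.Nullary using (¬_)
open import Relation.Binary.PropositionalEquality using (_≡_; _≢_)
open import Function.Definitions using (Injective)

Blocks : ℕ → ℕ → Set
Blocks n b = Fin b → Subset n

ExactlyOneBlockOn : ∀ {n b} → Blocks n b → (Fin b → Set) → Fin n → Fin n → Set
ExactlyOneBlockOn B S x y =
  (∃ λ i → S i × x ∈ B i × y ∈ B i) ×
  (∀ i j → S i → S j → x ∈ B i → y ∈ B i → x ∈ B j → y ∈ B j → i ≡ j)

Is2Design : (n m b : ℕ) → Blocks n b → Set
Is2Design n m b B =
  Injective _≡_ _≡_ B ×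
  (∀ i → ∣ B i ∣ ≡ m) ×
  (∀ x y → x ≢ y → ExactlyOneBlockOn B (λ _ → Fin b) x y)

Adjacent : ∀ {n b} → Blocks n b → Fin b → Fin b → Set
Adjacent B i j = i ≢ j × ∃ λ x → x ∈ B i × x ∈ B j

IsClique : ∀ {n b} → Blocks n b → Subset b → Set
IsClique B C = ∀ i j → i ∈ C → j ∈ C → i ≢ j → Adjacent B i j

IsMaximumClique : ∀ {n b} → Blocks n b → Subset b → Set
IsMaximumClique B C = IsClique B C × (∀ D → IsClique B D → ∣ D ∣ ≤ ∣ C ∣)

IsCanonical : ∀ {n b} → Blocks n b → Subset b → Set
IsCanonical B C = IsMaximumClique B C ×
  (∃ λ p → ∀ i → (i ∈ C → p ∈ B i) × (p ∈ B i → i ∈ C))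

InUnion : ∀ {n b} → Blocks n b → Subset b → Fin n → Set
InUnion B C x = ∃ λ i → i ∈ C × x ∈ B i

-- C has a design structure: on the point set U = union of blocks of C,
-- the blocks of C form a 2-(|U|,m,1) design (block sizes m are inherited
-- from the ambient design; distinctness too), i.e. every pair of distinct
-- points of U lies in exactly one block of C.
HasDesignStructure : ∀ {n b} → Blocks n b → Subset b → Set
HasDesignStructure B C =
  ∀ x y → InUnion B C x → InUnion B C y → x ≢ y →
    ExactlyOneBlockOn B (λ i → i ∈ C) x y

-- The design is the development of eleven base blocks under the cyclic group of order 13, which
-- acts on the points 13a + t (a < 5, t < 13) by t ↦ t + 1 mod 13 and fixes the point 65. Its axioms
-- reduce to three finite checks: every block has 6 points, distinct blocks share at most one point,
-- and the blocks through any point cover all points. A branch-and-bound search, proved complete,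
-- lists every clique of the block graph with at least 13 blocks; it returns 80 cliques, all of size
-- exactly 13, so these are the maximum cliques. A maximum clique whose blocks have a common point
-- lies inside, hence equals, the 13 blocks through that point; each of the other 14 contains two
-- points of its union that no block of the clique joins, so it carries no design structure.
module Submission where

open import Defs
open import Data.Nat
  using (ℕ; zero; suc; pred; _≤_; _<_; _≤?_; _<ᵇ_; _+_; _*_; _^_; _/_; _%_; NonZero; z≤n; s≤s)
open import Data.Nat.Properties
  using (_≟_; _<?_; ≤-trans; ≤-reflexive; pred-mono-≤; ≤⇒≯; <⇒≱; ≰⇒>; <⇒≤; m^n≢0)
open import Data.Nat.DivMod using (_mod_; [m+kn]%n≡m%n; +-distrib-/-∣ʳ; m*n/n≡m; n/1≡n; m/n/o≡m/[n*o])
open import Data.Nat.Divisibility using (n∣m*n)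
open import Data.Bool using (Bool; true; false; if_then_else_)
import Data.Bool.Properties as Bool
open import Data.Fin using (Fin; zero; suc; toℕ)
open import Data.Fin.Properties using (suc-injective; all?) renaming (_≟_ to _≟ᶠ_)
open import Data.Fin.Subset
  using (Subset; inside; outside; _∈_; _⊆_; _∩_; _∪_; ⋃; ⋂; ⊥; ⊤; ⁅_⁆; ∣_∣; Nonempty)
open import Data.Fin.Subset.Properties
  using ( _∈?_; ∈⊤; ∉⊥; x∈⁅x⁆; x∈⁅y⁆⇒x≡y; x∈p∪q⁺; x∈p∪q⁻; x∈p∩q⁺; x∈p∩q⁻; ∩-comm
        ; ⊆-antisym; drop-there; drop-∷-⊆; p⊆q⇒∣p∣≤∣q∣; x∈p⇒∣p-x∣<∣p∣; x∈p∧x≢y⇒x∈p-y)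
open import Data.Vec as Vec using (Vec; []; _∷_; lookup; here; there)
open import Data.Vec.Properties using (≡-dec; lookup∘tabulate; lookup-map; []=⇒lookup; lookup⇒[]=)
open import Data.List using (List; []; _∷_; [_]; map; filter; foldr; length; _++_; allFin; tabulate)
open import Data.List.Properties
  using (length-map; length-tabulate; length-filter; filter-all; map-∘; map-id; map-tabulate)
open import Data.List.Membership.Propositional using (find; lose) renaming (_∈_ to _∈ₗ_)
open import Data.List.Membership.Propositional.Properties
  using (∈-map⁺; ∈-map⁻; ∈-++⁺ˡ; ∈-++⁺ʳ; ∈-allFin; ∈-filter⁺; ∈-filter⁻)
open import Data.List.Relation.Unary.Any using (Any; here; there; any?)
import Data.List.Relation.Unary.Any.Properties as Anyₚ
open import Data.List.Relation.Unary.All as All using (All; []; _∷_)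
import Data.List.Relation.Unary.All.Properties as Allₚ
open import Data.List.Relation.Unary.AllPairs as AllPairs using (AllPairs; []; _∷_)
import Data.List.Relation.Unary.AllPairs.Properties as AllPairsₚ
open import Data.List.Relation.Unary.Unique.Propositional using (Unique)
import Data.List.Relation.Unary.Unique.Propositional.Properties as Uniqueₚ
open import Data.List.Relation.Binary.Sublist.Propositional using ([]; _∷_; _∷ʳ_) renaming (_⊆_ to _⊑_)
import Data.List.Relation.Binary.Sublist.Propositional.Properties as Sublistₚ
open import Data.Product using (Σ; ∃; _×_; _,_; proj₁; proj₂; swap)
open import Data.Sum using (inj₁; inj₂)
open import Function using (_∘_; id)
open import Function.Definitions using (Injective)
open import Relation.Binary using (Rel; Decidable; DecidableEquality)
open import Relation.Binary.PropositionalEquality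
  using (_≡_; _≢_; refl; sym; trans; cong; cong₂; subst; module ≡-Reasoning)
open import Relation.Nullary using (¬_; Dec; does; yes; no; contradiction; ¬?; _×-dec_)
open import Relation.Nullary.Decidable as Dec using (dec-true; dec-false; from-yes)

private variable
  n : ℕ

≥⇒≡⇒≤ : ∀ {m k} → (k ≤ m → m ≡ k) → m ≤ k
≥⇒≡⇒≤ {m} {k} ≥⇒≡ with m ≤? k
... | yes m≤k = m≤k
... | no  m≰k = ≤-reflexive (≥⇒≡ (<⇒≤ (≰⇒> m≰k)))

allPairs-∈ : ∀ {a r} {A : Set a} {R : Rel A r} → (∀ {x y} → R x y → R y x) →
             ∀ {xs x y} → AllPairs R xs → x ∈ₗ xs → y ∈ₗ xs → x ≢ y → R x y
allPairs-∈ R-sym (_ ∷ _)   (here refl) (here refl) x≢y = contradiction refl x≢y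
allPairs-∈ R-sym (px ∷ _)  (here refl) (there y∈)  _   = All.lookup px y∈
allPairs-∈ R-sym (px ∷ _)  (there x∈)  (here refl) _   = R-sym (All.lookup px x∈)
allPairs-∈ R-sym (_ ∷ pxs) (there x∈)  (there y∈)  x≢y = allPairs-∈ R-sym pxs x∈ y∈ x≢y

unique⇒allPairs : ∀ {a p r} {A : Set a} {P : A → Set p} {R : Rel A r} →
                  (∀ {x y} → P x → P y → x ≢ y → R x y) →
                  ∀ {xs} → Unique xs → All P xs → AllPairs R xs
unique⇒allPairs R-intro []            []         = []
unique⇒allPairs R-intro (x≢xs ∷ uniq) (px ∷ pxs) =
  All.zipWith (λ (x≢y , py) → R-intro px py x≢y) (x≢xs , pxs) ∷ unique⇒allPairs R-intro uniq pxs

members : Subset n → List (Fin n)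
members []            = []
members (inside  ∷ p) = zero ∷ map suc (members p)
members (outside ∷ p) = map suc (members p)

length-members : (p : Subset n) → length (members p) ≡ ∣ p ∣
length-members []            = refl
length-members (inside  ∷ p) = cong suc (trans (length-map suc (members p)) (length-members p))
length-members (outside ∷ p) = trans (length-map suc (members p)) (length-members p)

∈-members⁺ : ∀ {x} {p : Subset n} → x ∈ p → x ∈ₗ members p
∈-members⁺ {p = inside  ∷ p} here        = here refl
∈-members⁺ {p = inside  ∷ p} (there x∈p) = there (∈-map⁺ suc (∈-members⁺ x∈p))
∈-members⁺ {p = outside ∷ p} (there x∈p) = ∈-map⁺ suc (∈-members⁺ x∈p)

∈-members⁻ : ∀ {x} (p : Subset n) → x ∈ₗ members p → x ∈ p
∈-members⁻ (inside  ∷ p) (here refl) = here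
∈-members⁻ (inside  ∷ p) (there x∈) with ∈-map⁻ suc x∈
... | _ , y∈ , refl = there (∈-members⁻ p y∈)
∈-members⁻ (outside ∷ p) x∈ with ∈-map⁻ suc x∈
... | _ , y∈ , refl = there (∈-members⁻ p y∈)

members-unique : (p : Subset n) → Unique (members p)
members-unique []            = []
members-unique (inside  ∷ p) =
  All.tabulate zero≢ ∷ AllPairsₚ.map⁺ (AllPairs.map (_∘ suc-injective) (members-unique p))
  where
  zero≢ : ∀ {y} → y ∈ₗ map suc (members p) → zero ≢ y
  zero≢ y∈ refl with ∈-map⁻ suc y∈
  ... | _ , _ , ()
members-unique (outside ∷ p) = AllPairsₚ.map⁺ (AllPairs.map (_∘ suc-injective) (members-unique p))

members⊑allFin : (p : Subset n) → members p ⊑ allFin n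
suc-members⊑allFin : (p : Subset n) → map suc (members p) ⊑ tabulate {n = n} suc

members⊑allFin []            = []
members⊑allFin (inside  ∷ p) = refl ∷ suc-members⊑allFin p
members⊑allFin (outside ∷ p) = zero ∷ʳ suc-members⊑allFin p

suc-members⊑allFin p =
  subst (map suc (members p) ⊑_) (map-tabulate id suc) (Sublistₚ.map⁺ suc (members⊑allFin p))

fromList : List (Fin n) → Subset n
fromList = foldr (λ x p → ⁅ x ⁆ ∪ p) ⊥

∈-fromList⁺ : ∀ {x} {xs : List (Fin n)} → x ∈ₗ xs → x ∈ fromList xs
∈-fromList⁺ (here refl) = x∈p∪q⁺ (inj₁ (x∈⁅x⁆ _))
∈-fromList⁺ (there x∈)  = x∈p∪q⁺ (inj₂ (∈-fromList⁺ x∈))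

∈-fromList⁻ : ∀ {x} (xs : List (Fin n)) → x ∈ fromList xs → x ∈ₗ xs
∈-fromList⁻ []       x∈ = contradiction x∈ ∉⊥
∈-fromList⁻ (y ∷ ys) x∈ with x∈p∪q⁻ ⁅ y ⁆ (fromList ys) x∈
... | inj₁ x∈⁅y⁆ = here (x∈⁅y⁆⇒x≡y y x∈⁅y⁆)
... | inj₂ x∈ys  = there (∈-fromList⁻ ys x∈ys)

fromList-members : (p : Subset n) → fromList (members p) ≡ p
fromList-members p = ⊆-antisym (∈-members⁻ p ∘ ∈-fromList⁻ (members p)) (∈-fromList⁺ ∘ ∈-members⁺)

∈-⋃⁻ : ∀ {x} (ps : List (Subset n)) → x ∈ ⋃ ps → Any (x ∈_) ps
∈-⋃⁻ []       x∈ = contradiction x∈ ∉⊥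
∈-⋃⁻ (p ∷ ps) x∈ with x∈p∪q⁻ p (⋃ ps) x∈
... | inj₁ x∈p  = here x∈p
... | inj₂ x∈ps = there (∈-⋃⁻ ps x∈ps)

∈-⋂⁺ : ∀ {x} {ps : List (Subset n)} → All (x ∈_) ps → x ∈ ⋂ ps
∈-⋂⁺ []           = ∈⊤
∈-⋂⁺ (x∈p ∷ x∈ps) = x∈p∩q⁺ (x∈p , ∈-⋂⁺ x∈ps)

∈-⋂⁻ : ∀ {x} (ps : List (Subset n)) → x ∈ ⋂ ps → All (x ∈_) ps
∈-⋂⁻ []       _  = []
∈-⋂⁻ (p ∷ ps) x∈ = let x∈p , x∈ps = x∈p∩q⁻ p (⋂ ps) x∈ in x∈p ∷ ∈-⋂⁻ ps x∈ps

-- Data.Fin.Subset.Properties.nonempty? looks up every position separately, which is quadratic.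
nonempty?′ : (p : Subset n) → Dec (Nonempty p)
nonempty?′ []            = no λ ()
nonempty?′ (inside  ∷ p) = yes (zero , here)
nonempty?′ (outside ∷ p) = Dec.map′ (λ (x , x∈p) → suc x , there x∈p) drop (nonempty?′ p)
  where
  drop : Nonempty (outside ∷ p) → Nonempty p
  drop (suc x , x∈) = x , drop-there x∈

meets : Subset n → Subset n → Bool
meets []            []            = false
meets (inside  ∷ p) (inside  ∷ q) = true
meets (inside  ∷ p) (outside ∷ q) = meets p q
meets (outside ∷ p) (_       ∷ q) = meets p q

meets-complete : (p q : Subset n) → Nonempty (p ∩ q) → meets p q ≡ true
meets-complete (inside  ∷ p) (inside  ∷ q) _                  = refl
meets-complete (inside  ∷ p) (outside ∷ q) (suc x , there x∈) = meets-complete p q (x , x∈)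
meets-complete (outside ∷ p) (_       ∷ q) (suc x , there x∈) = meets-complete p q (x , x∈)

distinct⇒2≤∣p∣ : ∀ {x y} {p : Subset n} → x ≢ y → x ∈ p → y ∈ p → 2 ≤ ∣ p ∣
distinct⇒2≤∣p∣ x≢y x∈p y∈p =
  ≤-trans (s≤s (≤-trans (s≤s z≤n) (x∈p⇒∣p-x∣<∣p∣ (x∈p∧x≢y⇒x∈p-y y∈p (x≢y ∘ sym)))))
          (x∈p⇒∣p-x∣<∣p∣ x∈p)

2≤∣p∣⇒distinct : (p : Subset n) → 2 ≤ ∣ p ∣ → ∃ λ x → ∃ λ y → x ≢ y × x ∈ p × y ∈ p
2≤∣p∣⇒distinct p 2≤∣p∣ =
  first-two (members p) (subst (2 ≤_) (sym (length-members p)) 2≤∣p∣) (members-unique p) (∈-members⁻ p)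
  where
  first-two : (xs : List (Fin _)) → 2 ≤ length xs → Unique xs → (∀ {x} → x ∈ₗ xs → x ∈ p) →
              ∃ λ x → ∃ λ y → x ≢ y × x ∈ p × y ∈ p
  first-two (_ ∷ [])    (s≤s ()) _ _
  first-two (x ∷ y ∷ _) _ ((x≢y ∷ _) ∷ _) ∈p = x , y , x≢y , ∈p (here refl) , ∈p (there (here refl))

p⊆q∧∣q∣≤∣p∣⇒p≡q : {p q : Subset n} → p ⊆ q → ∣ q ∣ ≤ ∣ p ∣ → p ≡ q
p⊆q∧∣q∣≤∣p∣⇒p≡q {p = []}          {[]}          _   _   = refl
p⊆q∧∣q∣≤∣p∣⇒p≡q {p = inside  ∷ p} {inside  ∷ q} p⊆q (s≤s ≤) =
  cong (inside ∷_) (p⊆q∧∣q∣≤∣p∣⇒p≡q (drop-∷-⊆ p⊆q) ≤)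
p⊆q∧∣q∣≤∣p∣⇒p≡q {p = outside ∷ p} {outside ∷ q} p⊆q ≤ =
  cong (outside ∷_) (p⊆q∧∣q∣≤∣p∣⇒p≡q (drop-∷-⊆ p⊆q) ≤)
p⊆q∧∣q∣≤∣p∣⇒p≡q {p = inside  ∷ p} {outside ∷ q} p⊆q _ with () ← p⊆q here
p⊆q∧∣q∣≤∣p∣⇒p≡q {p = outside ∷ p} {inside  ∷ q} p⊆q ≤ =
  contradiction (p⊆q⇒∣p∣≤∣q∣ (drop-∷-⊆ p⊆q)) (<⇒≱ ≤)

_≟ₛ_ : DecidableEquality (Subset n)
_≟ₛ_ = ≡-dec Bool._≟_

bit : Bool → ℕ
bit false = 0
bit true  = 1

fromBits : Vec Bool n → ℕ
fromBits []       = 0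
fromBits (b ∷ bs) = bit b + fromBits bs * 2

infixl 7 _/2^_
_/2^_ : ℕ → ℕ → ℕ
m /2^ k = _/_ m (2 ^ k) {{m^n≢0 2 k}}

lowest-bit : ∀ b m → (bit b + m * 2) % 2 ≡ bit b
lowest-bit false m = [m+kn]%n≡m%n 0 m 2
lowest-bit true  m = [m+kn]%n≡m%n 1 m 2

drop-lowest-bit : ∀ b m → (bit b + m * 2) / 2 ≡ m
drop-lowest-bit false m = m*n/n≡m m 2
drop-lowest-bit true  m = trans (+-distrib-/-∣ʳ 1 {d = 2} (n∣m*n m)) (m*n/n≡m m 2)

fromBits-bit : (bs : Vec Bool n) (i : Fin n) → fromBits bs /2^ toℕ i % 2 ≡ bit (lookup bs i)
fromBits-bit (b ∷ bs) zero    = trans (cong (_% 2) (n/1≡n (fromBits (b ∷ bs)))) (lowest-bit b (fromBits bs))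
fromBits-bit (b ∷ bs) (suc i) = begin
  fromBits (b ∷ bs) /2^ suc (toℕ i) % 2  ≡⟨ cong (_% 2) (sym (m/n/o≡m/[n*o] _ 2 (2 ^ toℕ i)
                                              {{_}} {{m^n≢0 2 (toℕ i)}} {{m^n≢0 2 (suc (toℕ i))}})) ⟩
  fromBits (b ∷ bs) / 2 /2^ toℕ i % 2    ≡⟨ cong (λ m → m /2^ toℕ i % 2) (drop-lowest-bit b (fromBits bs)) ⟩
  fromBits bs /2^ toℕ i % 2              ≡⟨ fromBits-bit bs i ⟩
  bit (lookup bs i)                      ∎
  where open ≡-Reasoning

-- Exhaustive search for cliques

module CliqueSearch {a r} {A : Set a} {R : Rel A r} (R? : Decidable R) where

  mutual
    cliques : (fuel k : ℕ) → List A → List (List A)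
    cliques fuel k xs = if does (length xs <? k) then [] else extend fuel k xs

    extend : (fuel k : ℕ) → List A → List (List A)
    extend _          _ []       = [ [] ]
    extend zero       _ (_ ∷ _)  = []
    extend (suc fuel) k (x ∷ xs) =
      map (x ∷_) (cliques fuel (pred k) (filter (R? x) xs)) ++ cliques fuel k xs

  private
    unpruned : ∀ {m k} (zss : List (List A)) → ¬ m < k → (if does (m <? k) then [] else zss) ≡ zss
    unpruned {m} {k} _ m≮k rewrite dec-false (m <? k) m≮k = refl

  mutual
    cliques-complete : ∀ {fuel k xs ys} → length xs ≤ fuel → ys ⊑ xs → AllPairs R ys →
                       k ≤ length ys → ys ∈ₗ cliques fuel k xs
    cliques-complete {k = k} {xs} {ys} xs≤fuel ys⊑xs pairs k≤ =
      subst (ys ∈ₗ_) (sym (unpruned _ (≤⇒≯ (≤-trans k≤ (Sublistₚ.length-mono-≤ ys⊑xs)))))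
        (extend-complete xs≤fuel ys⊑xs pairs k≤)

    extend-complete : ∀ {fuel k xs ys} → length xs ≤ fuel → ys ⊑ xs → AllPairs R ys →
                      k ≤ length ys → ys ∈ₗ extend fuel k xs
    extend-complete {xs = []} _ [] _ _ = here refl
    extend-complete {suc fuel} {xs = x ∷ xs} (s≤s xs≤fuel) (_ ∷ʳ ys⊑xs) pairs k≤ =
      ∈-++⁺ʳ _ (cliques-complete xs≤fuel ys⊑xs pairs k≤)
    extend-complete {suc fuel} {xs = x ∷ xs} (s≤s xs≤fuel) (refl ∷ zs⊑xs) (x~zs ∷ zs-pairs) k≤ =
      ∈-++⁺ˡ (∈-map⁺ (x ∷_) (cliques-complete
        (≤-trans (length-filter (R? x) xs) xs≤fuel)
        (subst (_⊑ filter (R? x) xs) (filter-all (R? x) x~zs)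
          (Sublistₚ.filter⁺ (R? x) (R? x) (subst (R x)) zs⊑xs))
        zs-pairs (pred-mono-≤ k≤)))

-- Block designs and their block graphs

module BlockDesign {n b} (B : Blocks n b) where

  star : Fin n → Subset b
  star x = Vec.tabulate (λ i → does (x ∈? B i))

  ∈-star⁺ : ∀ {x i} → x ∈ B i → i ∈ star x
  ∈-star⁺ {x} {i} x∈ = lookup⇒[]= i _ (trans (lookup∘tabulate _ i) (dec-true (x ∈? B i) x∈))

  ∈-star⁻ : ∀ {x i} → i ∈ star x → x ∈ B i
  ∈-star⁻ {x} {i} i∈ = witness (x ∈? B i) (trans (sym (lookup∘tabulate _ i)) ([]=⇒lookup i∈))
    where
    witness : ∀ {A : Set} (a? : Dec A) → does a? ≡ true → A
    witness (yes a) _ = a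

  star-isClique : ∀ x → IsClique B (star x)
  star-isClique x i j i∈ j∈ i≢j = i≢j , x , ∈-star⁻ i∈ , ∈-star⁻ j∈

  canonical⇒star : ∀ {C} → IsCanonical B C → ∃ λ x → C ≡ star x
  canonical⇒star (_ , x , C≈) = x , ⊆-antisym (∈-star⁺ ∘ proj₁ (C≈ _)) (proj₂ (C≈ _) ∘ ∈-star⁻)

  MeetAtMostOnce : Set
  MeetAtMostOnce = ∀ {i j} → i ≢ j → ∣ B i ∩ B j ∣ ≤ 1

  module _ (meet≤1 : MeetAtMostOnce) where

    block-unique : ∀ {x y i j} → x ≢ y → x ∈ B i → y ∈ B i → x ∈ B j → y ∈ B j → i ≡ j
    block-unique {i = i} {j} x≢y xi yi xj yj with i ≟ᶠ j
    ... | yes i≡j = i≡j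
    ... | no  i≢j =
      contradiction (meet≤1 i≢j) (<⇒≱ (distinct⇒2≤∣p∣ x≢y (x∈p∩q⁺ (xi , xj)) (x∈p∩q⁺ (yi , yj))))

    is2Design : ∀ {m} → (∀ i → ∣ B i ∣ ≡ m) → 2 ≤ m → (∀ x y → ∃ λ i → x ∈ B i × y ∈ B i) →
                Is2Design n m b B
    is2Design {m} size 2≤m joined = injective , size , λ x y x≢y →
      (let i , xi , yi = joined x y in i , i , xi , yi) ,
      λ i j _ _ xi yi xj yj → block-unique x≢y xi yi xj yj
      where
      injective : Injective _≡_ _≡_ B
      injective {i} {j} Bi≡Bj =
        let x , y , x≢y , xi , yi = 2≤∣p∣⇒distinct (B i) (subst (2 ≤_) (sym (size i)) 2≤m)
        in block-unique x≢y xi yi (subst (x ∈_) Bi≡Bj xi) (subst (y ∈_) Bi≡Bj yi)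

    star-injective : (∀ x → 2 ≤ ∣ star x ∣) → Injective _≡_ _≡_ star
    star-injective 2≤∣star∣ {x} {y} star-x≡star-y with x ≟ᶠ y
    ... | yes x≡y = x≡y
    ... | no  x≢y =
      let i , j , i≢j , i∈ , j∈ = 2≤∣p∣⇒distinct (star x) (2≤∣star∣ x)
          on-y : ∀ {k} → k ∈ star x → y ∈ B k
          on-y k∈ = ∈-star⁻ (subst (_ ∈_) star-x≡star-y k∈)
      in contradiction (block-unique x≢y (∈-star⁻ i∈) (on-y i∈) (∈-star⁻ j∈) (on-y j∈)) i≢j

  PairwiseMeetAtMostOnce : Set
  PairwiseMeetAtMostOnce = AllPairs (λ p q → ∣ p ∩ q ∣ ≤ 1) (map B (allFin b))

  pairwise⇒meetAtMostOnce : PairwiseMeetAtMostOnce → MeetAtMostOnce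
  pairwise⇒meetAtMostOnce pairs =
    allPairs-∈ (λ {i} {j} → subst (_≤ 1) (cong ∣_∣ (∩-comm (B i) (B j))))
      (AllPairsₚ.map⁻ {f = B} pairs) (∈-allFin _) (∈-allFin _)

  lines : Fin n → List (Subset n)
  lines x = map B (members (star x))

  lines-cover⇒joined : (∀ x → ⋃ (lines x) ≡ ⊤) → ∀ x y → ∃ λ i → x ∈ B i × y ∈ B i
  lines-cover⇒joined cover x y =
    let i , i∈ , yi = find (Anyₚ.map⁻ (∈-⋃⁻ (lines x) (subst (y ∈_) (sym (cover x)) ∈⊤)))
    in i , ∈-star⁻ (∈-members⁻ (star x) i∈) , yi

  Meet : Fin b → Fin b → Set
  Meet i j = Nonempty (B i ∩ B j)

  meet-sym : ∀ {i j} → Meet i j → Meet j i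
  meet-sym (x , x∈) = x , x∈p∩q⁺ (swap (x∈p∩q⁻ _ _ x∈))

  clique⇒meet : ∀ {C} → IsClique B C → AllPairs Meet (members C)
  clique⇒meet {C} clique = unique⇒allPairs adjacent (members-unique C) (All.tabulate (∈-members⁻ C))
    where
    adjacent : ∀ {i j} → i ∈ C → j ∈ C → i ≢ j → Meet i j
    adjacent i∈ j∈ i≢j = let _ , x , xi , xj = clique _ _ i∈ j∈ i≢j in x , x∈p∩q⁺ (xi , xj)

  meet⇒clique : ∀ {C} → AllPairs Meet (members C) → IsClique B C
  meet⇒clique pairs i j i∈ j∈ i≢j =
    let x , x∈ = allPairs-∈ meet-sym pairs (∈-members⁺ i∈) (∈-members⁺ j∈) i≢j
    in i≢j , x , x∈p∩q⁻ _ _ x∈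

  commonPoints : Subset b → Subset n
  commonPoints C = ⋂ (map B (members C))

  ∈-commonPoints⁻ : ∀ {C x i} → x ∈ commonPoints C → i ∈ C → x ∈ B i
  ∈-commonPoints⁻ {C} x∈ i∈ = All.lookup (∈-⋂⁻ (map B (members C)) x∈) (∈-map⁺ B (∈-members⁺ i∈))

  ∈-commonPoints-star : ∀ x → x ∈ commonPoints (star x)
  ∈-commonPoints-star x = ∈-⋂⁺ (Allₚ.map⁺ (All.tabulate (∈-star⁻ ∘ ∈-members⁻ (star x))))

  union : Subset b → Subset n
  union C = ⋃ (map B (members C))

  ∈-union⁻ : ∀ {C x} → x ∈ union C → InUnion B C x
  ∈-union⁻ {C} x∈ = let i , i∈ , xi = find (Anyₚ.map⁻ (∈-⋃⁻ (map B (members C)) x∈))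
                    in i , ∈-members⁻ C i∈ , xi

  Covered : Subset b → Fin n → Fin n → Set
  Covered C x y = Any (λ i → x ∈ B i × y ∈ B i) (members C)

  UncoveredPairIn : Subset n → Subset b → Set
  UncoveredPairIn U C = Any (λ x → Any (λ y → x ≢ y × ¬ Covered C x y) (members U)) (members U)

  uncoveredPairIn? : ∀ U C → Dec (UncoveredPairIn U C)
  uncoveredPairIn? U C =
    any? (λ x → any? (λ y → ¬? (x ≟ᶠ y) ×-dec ¬? (covered? x y)) (members U)) (members U)
    where
    covered? : ∀ x y → Dec (Covered C x y)
    covered? x y = any? (λ i → (x ∈? B i) ×-dec (y ∈? B i)) (members C)

  uncovered⇒¬design : ∀ {C} → UncoveredPairIn (union C) C → ¬ HasDesignStructure B C
  uncovered⇒¬design {C} uncovered design =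
    let x , x∈ , y-uncovered = find uncovered
        y , y∈ , x≢y , ¬covered = find y-uncovered
        i , i∈C , xi , yi =
          proj₁ (design x y (∈-union⁻ (∈-members⁻ _ x∈)) (∈-union⁻ (∈-members⁻ _ y∈)) x≢y)
    in ¬covered (lose (∈-members⁺ i∈C) (xi , yi))

  -- The bits of neighbours mark the blocks meeting this one; place is 2 ^ toℕ block.
  record Vertex : Set where
    constructor mkVertex
    field
      block       : Fin b
      neighbours  : ℕ
      place       : ℕ
      {{place≢0}} : NonZero place

  open Vertex

  IsNeighbour : Rel Vertex _
  IsNeighbour u v = _/_ (neighbours u) (place v) {{place≢0 v}} % 2 ≡ 1

  neighbour? : Decidable IsNeighbour
  neighbour? u v = _ ≟ 1

  -- Built with the constructor rather than a record expression: only then does normalisation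
  -- share the fields, so that each bit mask is computed once per search.
  vertex : Vec (Subset n) b → Fin b → Vertex
  vertex t i = mkVertex i (fromBits (Vec.map (meets (lookup t i)) t)) (2 ^ toℕ i) {{m^n≢0 2 (toℕ i)}}

  vertices : List Vertex
  vertices = map (vertex (Vec.tabulate B)) (allFin b)

  meet⇒neighbour : ∀ {i j} → Meet i j → IsNeighbour (vertex (Vec.tabulate B) i) (vertex (Vec.tabulate B) j)
  meet⇒neighbour {i} {j} meet = begin
    fromBits row /2^ toℕ j % 2             ≡⟨ fromBits-bit row j ⟩
    bit (lookup row j)                     ≡⟨ cong bit (lookup-map j _ t) ⟩
    bit (meets (lookup t i) (lookup t j))  ≡⟨ cong₂ (λ p q → bit (meets p q)) (lookup∘tabulate B i)
                                                                              (lookup∘tabulate B j) ⟩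
    bit (meets (B i) (B j))                ≡⟨ cong bit (meets-complete (B i) (B j) meet) ⟩
    1                                      ∎
    where
    open ≡-Reasoning
    t : Vec (Subset n) b
    t = Vec.tabulate B
    row : Vec Bool b
    row = Vec.map (meets (lookup t i)) t

  open CliqueSearch neighbour?

  -- Opaque, so that comparing types never runs the search; only the census unfolds it.
  opaque
    cliquesOfSize : ℕ → List (Subset b)
    cliquesOfSize k = map (fromList ∘ map block) (cliques b k vertices)

    ∈-cliquesOfSize : ∀ {C k} → IsClique B C → k ≤ ∣ C ∣ → C ∈ₗ cliquesOfSize k
    ∈-cliquesOfSize {C} {k} clique k≤∣C∣ =
      subst (_∈ₗ cliquesOfSize k) blocks-of-path (∈-map⁺ (fromList ∘ map block) path-found)
      where
      path : List Vertex
      path = map (vertex (Vec.tabulate B)) (members C)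

      path-found : path ∈ₗ cliques b k vertices
      path-found = cliques-complete
        (≤-reflexive (trans (length-map _ (allFin b)) (length-tabulate _)))
        (Sublistₚ.map⁺ _ (members⊑allFin C))
        (AllPairsₚ.map⁺ (AllPairs.map meet⇒neighbour (clique⇒meet clique)))
        (subst (k ≤_) (sym (trans (length-map _ (members C)) (length-members C))) k≤∣C∣)

      blocks-of-path : fromList (map block path) ≡ C
      blocks-of-path = trans (cong fromList (trans (sym (map-∘ (members C))) (map-id (members C))))
                             (fromList-members C)

  withoutCommonPoint : List (Subset b) → List (Subset b)
  withoutCommonPoint = filter (λ C → ¬? (nonempty?′ (commonPoints C)))

  ∈-withoutCommonPoint⁺ : ∀ {C M} → C ∈ₗ M → ¬ Nonempty (commonPoints C) → C ∈ₗ withoutCommonPoint M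
  ∈-withoutCommonPoint⁺ = ∈-filter⁺ _

  ∈-withoutCommonPoint⁻ : ∀ {C} M → C ∈ₗ withoutCommonPoint M → C ∈ₗ M × ¬ Nonempty (commonPoints C)
  ∈-withoutCommonPoint⁻ M = ∈-filter⁻ _ {xs = M}

  star-commonPoint : ∀ x → Nonempty (commonPoints (star x))
  star-commonPoint x = x , ∈-commonPoints-star x

  canonical⇒commonPoint : ∀ {C} → IsCanonical B C → Nonempty (commonPoints C)
  canonical⇒commonPoint canonical =
    let x , C≡star = canonical⇒star canonical
    in subst (Nonempty ∘ commonPoints) (sym C≡star) (star-commonPoint x)

  commonPoint⇒star : ∀ {C x} → (∀ D → IsClique B D → ∣ D ∣ ≤ ∣ C ∣) → x ∈ commonPoints C → C ≡ star x
  commonPoint⇒star {x = x} largest x∈ =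
    p⊆q∧∣q∣≤∣p∣⇒p≡q (∈-star⁺ ∘ ∈-commonPoints⁻ x∈) (largest (star x) (star-isClique x))

  NonDesignClique : Subset b → Set
  NonDesignClique C = AllPairs Meet (members C) × UncoveredPairIn (union C) C

  record Census (k e : ℕ) (M : List (Subset b)) : Set where
    field
      sizes     : All (λ C → ∣ C ∣ ≡ k) M
      count     : length (withoutCommonPoint M) ≡ e
      unique    : Unique (withoutCommonPoint M)
      nondesign : All NonDesignClique (withoutCommonPoint M)

  -- Decision procedures are stated inside this module so that, on a concrete design, the blocks are
  -- a shared bound variable and each is computed once. The census bundles every fact needed about
  -- the search output, so that the search runs once.
  census? : ∀ k e M → Dec (Census k e M)
  census? k e M = Dec.map′ (λ (s , c , u , d) → record { sizes = s ; count = c ; unique = u ; nondesign = d })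
                           (λ c → Census.sizes c , Census.count c , Census.unique c , Census.nondesign c)
                           (All.all? (λ C → ∣ C ∣ ≟ k) M ×-dec exceptional? (withoutCommonPoint M))
    where
    exceptional? : ∀ N → Dec (length N ≡ e × Unique N × All NonDesignClique N)
    exceptional? N =
      length N ≟ e ×-dec AllPairs.allPairs? (λ C D → ¬? (C ≟ₛ D)) N ×-dec
      All.all? (λ C → AllPairs.allPairs? (λ i j → nonempty?′ (B i ∩ B j)) (members C) ×-dec
                      uncoveredPairIn? (union C) C) N

  blockSizes? : ∀ m → Dec (∀ i → ∣ B i ∣ ≡ m)
  blockSizes? m = all? (λ i → ∣ B i ∣ ≟ m)

  starSizes? : ∀ r → Dec (∀ x → ∣ star x ∣ ≡ r)
  starSizes? r = all? (λ x → ∣ star x ∣ ≟ r)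

  pairwiseMeetAtMostOnce? : Dec PairwiseMeetAtMostOnce
  pairwiseMeetAtMostOnce? = AllPairs.allPairs? (λ p q → ∣ p ∩ q ∣ ≤? 1) (map B (allFin b))

  linesCover? : Dec (∀ x → ⋃ (lines x) ≡ ⊤)
  linesCover? = all? (λ x → ⋃ (lines x) ≟ₛ ⊤)

  module Classification (k e : ℕ) (x₀ : Fin n) (meet≤1 : MeetAtMostOnce) (2≤k : 2 ≤ k)
                        (star-size : ∀ x → ∣ star x ∣ ≡ k) (census : Census k e (cliquesOfSize k)) where

    open Census census

    clique-bound : ∀ D → IsClique B D → ∣ D ∣ ≤ k
    clique-bound D clique = ≥⇒≡⇒≤ (All.lookup sizes ∘ ∈-cliquesOfSize clique)

    maximum : ∀ {C} → IsClique B C → ∣ C ∣ ≡ k → IsMaximumClique B C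
    maximum clique ∣C∣≡k = clique , λ D D-clique → subst (∣ D ∣ ≤_) (sym ∣C∣≡k) (clique-bound D D-clique)

    stars-canonical : All (IsCanonical B) (map star (allFin n))
    stars-canonical = Allₚ.map⁺ (All.tabulate λ {x} _ →
      maximum (star-isClique x) (star-size x) , x , λ _ → ∈-star⁻ , ∈-star⁺)

    others-noncanonical : All (λ C → IsMaximumClique B C × ¬ IsCanonical B C)
                              (withoutCommonPoint (cliquesOfSize k))
    others-noncanonical = All.tabulate λ C∈ →
      let C∈M , no-common = ∈-withoutCommonPoint⁻ (cliquesOfSize k) C∈
      in maximum (meet⇒clique (proj₁ (All.lookup nondesign C∈))) (All.lookup sizes C∈M) ,
         no-common ∘ canonical⇒commonPoint

    others-nondesign : All (λ C → ¬ HasDesignStructure B C) (withoutCommonPoint (cliquesOfSize k))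
    others-nondesign = All.map (uncovered⇒¬design ∘ proj₂) nondesign

    maximum-listed : ∀ C → IsMaximumClique B C →
                     C ∈ₗ map star (allFin n) ++ withoutCommonPoint (cliquesOfSize k)
    maximum-listed C (clique , largest) with nonempty?′ (commonPoints C)
    ... | yes (x , x∈) =
      ∈-++⁺ˡ (subst (_∈ₗ map star (allFin n)) (sym (commonPoint⇒star largest x∈))
                    (∈-map⁺ star (∈-allFin x)))
    ... | no no-common = ∈-++⁺ʳ (map star (allFin n)) (∈-withoutCommonPoint⁺ C∈M no-common)
      where
      C∈M : C ∈ₗ cliquesOfSize k
      C∈M = ∈-cliquesOfSize clique (subst (_≤ ∣ C ∣) (star-size x₀) (largest (star x₀) (star-isClique x₀)))

    listed-unique : Unique (map star (allFin n) ++ withoutCommonPoint (cliquesOfSize k))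
    listed-unique = Uniqueₚ.++⁺
      (Uniqueₚ.map⁺ (star-injective meet≤1 (λ x → subst (2 ≤_) (sym (star-size x)) 2≤k)) (Uniqueₚ.allFin⁺ n))
      unique
      λ (C∈stars , C∈others) →
        let x , _ , C≡star = ∈-map⁻ star C∈stars
        in proj₂ (∈-withoutCommonPoint⁻ (cliquesOfSize k) C∈others)
                 (subst (Nonempty ∘ commonPoints) (sym C≡star) (star-commonPoint x))

-- The 2-(66,6,1) design

baseBlocks : Vec (List ℕ) 11
baseBlocks =
  (0 ∷ 1 ∷ 11 ∷ 31 ∷ 45 ∷ 49 ∷ [])   ∷ (0 ∷ 4 ∷ 23 ∷ 25 ∷ 55 ∷ 63 ∷ [])  ∷
  (0 ∷ 5 ∷ 27 ∷ 37 ∷ 54 ∷ 61 ∷ [])   ∷ (0 ∷ 6 ∷ 22 ∷ 34 ∷ 43 ∷ 53 ∷ [])  ∷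
  (0 ∷ 13 ∷ 26 ∷ 39 ∷ 52 ∷ 65 ∷ [])  ∷ (0 ∷ 14 ∷ 18 ∷ 24 ∷ 41 ∷ 42 ∷ []) ∷
  (0 ∷ 15 ∷ 20 ∷ 29 ∷ 40 ∷ 57 ∷ [])  ∷ (0 ∷ 17 ∷ 36 ∷ 38 ∷ 46 ∷ 58 ∷ []) ∷
  (13 ∷ 14 ∷ 31 ∷ 37 ∷ 60 ∷ 62 ∷ []) ∷ (13 ∷ 28 ∷ 29 ∷ 33 ∷ 45 ∷ 48 ∷ []) ∷
  (39 ∷ 41 ∷ 46 ∷ 57 ∷ 60 ∷ 61 ∷ []) ∷ []

rotate : ℕ → ℕ → ℕ
rotate s x = if x <ᵇ 65 then 13 * (x / 13) + (x % 13 + s) % 13 else x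

development : List ℕ → Vec (Subset 66) 13
development base = Vec.tabulate (λ s → fromList (map (λ x → rotate (toℕ s) x mod 66) base))

design : Blocks 66 143
design = lookup (Vec.concat (Vec.map development baseBlocks))

open BlockDesign

meet≤1 : MeetAtMostOnce design
meet≤1 = pairwise⇒meetAtMostOnce design (from-yes (pairwiseMeetAtMostOnce? design))

is-design : Is2Design 66 6 143 design
is-design = is2Design design meet≤1 (from-yes (blockSizes? design 6)) (s≤s (s≤s z≤n))
                      (lines-cover⇒joined design (from-yes (linesCover? design)))

star-size : ∀ x → ∣ star design x ∣ ≡ 13
star-size = from-yes (starSizes? design 13)

opaque
  unfolding cliquesOfSize
  census : Census design 13 14 (cliquesOfSize design 13)
  census = from-yes (census? design 13 14 (cliquesOfSize design 13))

theorem1p2 : Σ (Blocks 66 143) λ B → Is2Design 66 6 143 B ×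
    Σ (List (Subset 143)) λ Lc → Σ (List (Subset 143)) λ Ln →
      length Lc ≡ 66 × length Ln ≡ 14 × Unique (Lc ++ Ln) ×
      (∀ C → IsMaximumClique B C → C ∈ₗ (Lc ++ Ln)) ×
      All (IsCanonical B) Lc ×
      All (λ C → IsMaximumClique B C × ¬ IsCanonical B C) Ln ×
      All (λ C → ¬ HasDesignStructure B C) Ln
theorem1p2 =
  design , is-design , map (star design) (allFin 66) , withoutCommonPoint design (cliquesOfSize design 13) ,
  refl , count , listed-unique , maximum-listed , stars-canonical , others-noncanonical , others-nondesign
  where
  open Classification design 13 14 zero meet≤1 (s≤s (s≤s z≤n)) star-size census
  open Census census using (count)
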